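{- Let $t\colon X\to(\mathcal{P}X)^A$ be a labelled transition system with finite sets of successors, and let $\tilde t\colon X\to(\mathcal{P}\mathcal{D}X)^A$ be the NPLTS $\tilde t(x)(a)=\{\delta_{x'}\mid x'\in t(x)(a)\}$. Then the may-must, may and must trace equivalences of the LTS $t$ coincide, respectively, with the may-must trace equivalence $\equiv$, the may trace equivalence $\equiv_B$ and the must trace equivalence $\equiv_T$ of the NPLTS $\tilde t$.
   Context: LTS semantics: for a nonempty finite $S\subseteq X+\{\star\}$ and label $a$ let $S^a=\bigcup_{u\in S}\theta(u,a)$, where $\theta(\star,a)=\{\star\}$, $\theta(x,a)=\{\star\}$ if $t(x)(a)=\emptyset$ and $\theta(x,a)=t(x)(a)$ otherwise; $S^\varepsilon=S$, $S^{aw}=(S^a)^w$. Let $\mathrm{obs}(S)\subseteq\{\bullet,\star\}$ contain $\bullet$ iff $S\cap X\neq\emptyset$ and $\star$ iff $\star\in S$. LTS may-must trace equivalence: $x\equiv^{LTS}_*y$ iff $\mathrm{obs}(\{x\}^w)=\mathrm{obs}(\{y\}^w)$ for all $w\in A^*$; LTS may trace equivalence: $x\equiv^{LTS}_B y$ iff for all $w$, $\{x\}^w\cap X\neq\emptyset\Leftrightarrow\{y\}^w\cap X\neq\emptyset$; LTS must trace equivalence: $x\equiv^{LTS}_T y$ iff for all $w$, $\star\in\{x\}^w\Leftrightarrow\star\in\{y\}^w$. NPLTS semantics (for $t'\colon X\to(\mathcal P\mathcal D X)^A$, finite sets of finitely supported distributions, $\delta_x$ Dirac): terms $s::=x\mid\star\mid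 s\oplus s\mid s+_ps\ (p\in[0,1])$; $\tau(\emptyset)=\star$, $\tau(\{\Delta_1,\dots,\Delta_n\})=d_1\oplus\cdots\oplus d_n$ with $d_i$ a $+_p$-term over $X$ denoting $\Delta_i$ (reading $x$ as $\delta_x$; the semantics does not depend on the choice). For each label $a$: $x^a=\tau(t'(x)(a))$, $\star^a=\star$, $(s_1\oplus s_2)^a=s_1^a\oplus s_2^a$, $(s_1+_ps_2)^a=s_1^a+_ps_2^a$; $s^\varepsilon=s$, $s^{aw}=(s^a)^w$. Outputs: $o_B$: $x\mapsto1$, $\star\mapsto0$, $\oplus\mapsto\max$, $+_p\mapsto p\cdot-+(1-p)\cdot-$; $o_T$: same with $\min$; $o$ into closed intervals of $[0,1]$: $x\mapsto[1,1]$, $\star\mapsto[0,0]$, $\oplus\mapsto[\min$ of lower ends$,\max$ of upper ends$]$, $+_p\mapsto$ endpoint-wise convex combination. $x\equiv y$ iff $o(x^w)=o(y^w)$ for all $w$; $x\equiv_B y$ iff $o_B(x^w)=o_B(y^w)$ for all $w$; $x\equiv_T y$ iff $o_T(x^w)=o_T(y^w)$ for all $w$. -}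

module Defs where

open import Data.Bool using (Bool; true; false; _∨_)
open import Data.Maybe using (Maybe; just; nothing; is-just; is-nothing)
open import Data.List using (List; []; _∷_; map; concatMap)
open import Data.Bool.ListAction using (any)
open import Data.Product using (_×_; _,_)
open import Data.Rational using (ℚ; 0ℚ; 1ℚ; _+_; _*_; _-_; _⊔_; _⊓_; _≤_)
open import Relation.Binary.PropositionalEquality using (_≡_)

-- LTS with finite sets of successors:  t : X → (P_fin X)^A,
-- finite sets represented by lists.

LTS : Set → Set → Set
LTS X A = X → A → List X

-- X + {⋆} : just x = x ∈ X, nothing = ⋆
-- S^a = ⋃_{u ∈ S} θ(u,a)
module LTSSem {X A : Set} (t : LTS X A) where

  θ : Maybe X → A → List (Maybe X)
  θ nothing  a = nothing ∷ []
  θ (just x) a with t x a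
  ... | []       = nothing ∷ []
  ... | (y ∷ ys) = map just (y ∷ ys)

  stepS : List (Maybe X) → A → List (Maybe X)
  stepS S a = concatMap (λ u → θ u a) S

  runS : List (Maybe X) → List A → List (Maybe X)
  runS S []      = S
  runS S (a ∷ w) = runS (stepS S a) w

  -- obs(S) = (• ∈ obs S , ⋆ ∈ obs S)
  hasX : List (Maybe X) → Bool
  hasX S = any is-just S

  hasStar : List (Maybe X) → Bool
  hasStar S = any is-nothing S

  obs : List (Maybe X) → Bool × Bool
  obs S = hasX S , hasStar S

  _≡*_ : X → X → Set
  x ≡* y = ∀ (w : List A) → obs (runS (just x ∷ []) w) ≡ obs (runS (just y ∷ []) w)

  _≡B_ : X → X → Set
  x ≡B y = ∀ (w : List A) → hasX (runS (just x ∷ []) w) ≡ hasX (runS (just y ∷ []) w)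

  _≡T_ : X → X → Set
  x ≡T y = ∀ (w : List A) → hasStar (runS (just x ∷ []) w) ≡ hasStar (runS (just y ∷ []) w)

record Prob : Set where
  constructor prob
  field
    val  : ℚ
    0≤p  : 0ℚ ≤ val
    p≤1  : val ≤ 1ℚ
open Prob public

-- +_p-terms over X (finitely supported distributions, reading x as δ_x)
data Dist (X : Set) : Set where
  dvar : X → Dist X
  dmix : Prob → Dist X → Dist X → Dist X

data Term (X : Set) : Set where
  var  : X → Term X
  star : Term X
  _⊕_  : Term X → Term X → Term X
  mix  : Prob → Term X → Term X → Term X

-- NPLTS t' : X → (P D X)^A, each distribution given by a +_p-term
-- denoting it (the semantics does not depend on that choice).
NPLTS : Set → Set → Set
NPLTS X A = X → A → List (Dist X)

embD : {X : Set} → Dist X → Term X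
embD (dvar x)     = var x
embD (dmix p d e) = mix p (embD d) (embD e)

τ : {X : Set} → List (Dist X) → Term X
τ []           = star
τ (d ∷ [])     = embD d
τ (d ∷ e ∷ ds) = embD d ⊕ τ (e ∷ ds)

module NPLTSSem {X A : Set} (t' : NPLTS X A) where

  step : Term X → A → Term X
  step (var x)     a = τ (t' x a)
  step star        a = star
  step (s ⊕ s')    a = step s a ⊕ step s' a
  step (mix p s s') a = mix p (step s a) (step s' a)

  run : Term X → List A → Term X
  run s []      = s
  run s (a ∷ w) = run (step s a) w

  conv : Prob → ℚ → ℚ → ℚ
  conv p u v = val p * u + (1ℚ - val p) * v

  oB : Term X → ℚ
  oB (var x)      = 1ℚ
  oB star         = 0ℚ
  oB (s ⊕ s')     = oB s ⊔ oB s'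
  oB (mix p s s') = conv p (oB s) (oB s')

  oT : Term X → ℚ
  oT (var x)      = 1ℚ
  oT star         = 0ℚ
  oT (s ⊕ s')     = oT s ⊓ oT s'
  oT (mix p s s') = conv p (oT s) (oT s')

  -- closed intervals [l , u] as pairs of endpoints
  o : Term X → ℚ × ℚ
  o (var x)  = 1ℚ , 1ℚ
  o star     = 0ℚ , 0ℚ
  o (s ⊕ s') with o s | o s'
  ... | (l₁ , u₁) | (l₂ , u₂) = (l₁ ⊓ l₂) , (u₁ ⊔ u₂)
  o (mix p s s') with o s | o s'
  ... | (l₁ , u₁) | (l₂ , u₂) = conv p l₁ l₂ , conv p u₁ u₂

  _≡ᴺ_ : X → X → Set
  x ≡ᴺ y = ∀ (w : List A) → o (run (var x) w) ≡ o (run (var y) w)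

  _≡ᴺB_ : X → X → Set
  x ≡ᴺB y = ∀ (w : List A) → oB (run (var x) w) ≡ oB (run (var y) w)

  _≡ᴺT_ : X → X → Set
  x ≡ᴺT y = ∀ (w : List A) → oT (run (var x) w) ≡ oT (run (var y) w)

diracLift : {X A : Set} → LTS X A → NPLTS X A
diracLift t x a = map dvar (t x a)

module Submission where

open import Defs
open import Data.Bool using (Bool; true; false; not; _∨_)
open import Data.Bool.ListAction using (any)
open import Data.Bool.Properties using (not-injective)
open import Data.Empty using (⊥-elim)
open import Data.List using (List; []; _∷_; _++_; map)
open import Data.List.Properties using (++-identityʳ; concatMap-++)
open import Data.Maybe using (Maybe; just; nothing; is-just; is-nothing)
open import Data.Product using (_×_; _,_)
open import Data.Product.Properties using (,-injective)
open import Data.Rational using (ℚ; 0ℚ; 1ℚ; _⊔_; _⊓_)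
open import Data.Rational.Properties using (1≢0)
open import Function.Base using (_∘_)
open import Function.Bundles using (_⇔_; mk⇔)
open import Function.Definitions using (Injective)
open import Relation.Binary.PropositionalEquality using (_≡_; refl; sym; trans; cong; cong₂)

-- A Dirac lift never makes a proper probabilistic choice, so every term reached from a
-- state is a ⊕-combination of states and ⋆ whose leaves are exactly the LTS set S^w.
-- On such terms o_B is 1 iff a state occurs, o_T is 1 iff ⋆ does not, and o is the
-- interval [o_T, o_B]; these 0/1 encodings are injective, so equal outputs are the
-- same as equal observations.

any-++ : {B : Set} (p : B → Bool) (l m : List B) → any p (l ++ m) ≡ (any p l ∨ any p m)
any-++ p []      m = refl
any-++ p (u ∷ l) m with p u
... | true  = refl
... | false = any-++ p l m

indicator : Bool → ℚ
indicator true  = 1ℚ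
indicator false = 0ℚ

indicator-injective : Injective _≡_ _≡_ indicator
indicator-injective {true}  {true}  _ = refl
indicator-injective {true}  {false} e = ⊥-elim (1≢0 e)
indicator-injective {false} {true}  e = ⊥-elim (1≢0 (sym e))
indicator-injective {false} {false} _ = refl

indicator-∨ : ∀ a b → indicator a ⊔ indicator b ≡ indicator (a ∨ b)
indicator-∨ true  true  = refl
indicator-∨ true  false = refl
indicator-∨ false true  = refl
indicator-∨ false false = refl

indicator-not-∨ : ∀ a b → indicator (not a) ⊓ indicator (not b) ≡ indicator (not (a ∨ b))
indicator-not-∨ true  true  = refl
indicator-not-∨ true  false = refl
indicator-not-∨ false true  = refl
indicator-not-∨ false false = refl

obsInterval : Bool × Bool → ℚ × ℚ
obsInterval (hasState , hasStar) = indicator (not hasStar) , indicator hasState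

obsInterval-injective : Injective _≡_ _≡_ obsInterval
obsInterval-injective e with ,-injective e
... | eq₁ , eq₂ = cong₂ _,_ (indicator-injective eq₂) (not-injective (indicator-injective eq₁))

pointwise-≡-transfer : {W B C : Set} {h : B → C} → Injective _≡_ _≡_ h →
  {f g : W → B} {f' g' : W → C} → (∀ w → f' w ≡ h (f w)) → (∀ w → g' w ≡ h (g w)) →
  (∀ w → f w ≡ g w) ⇔ (∀ w → f' w ≡ g' w)
pointwise-≡-transfer {h = h} h-injective f'≡hf g'≡hg = mk⇔
  (λ f≡g w → trans (f'≡hf w) (trans (cong h (f≡g w)) (sym (g'≡hg w))))
  (λ f'≡g' w → h-injective (trans (sym (f'≡hf w)) (trans (f'≡g' w) (g'≡hg w))))

leaves : {X : Set} → Term X → List (Maybe X)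
leaves (var x)      = just x ∷ []
leaves star         = nothing ∷ []
leaves (s ⊕ s')     = leaves s ++ leaves s'
leaves (mix p s s') = leaves s ++ leaves s'

data MixFree {X : Set} : Term X → Set where
  var  : ∀ x → MixFree (var x)
  star : MixFree star
  _⊕_  : ∀ {s s'} → MixFree s → MixFree s' → MixFree (s ⊕ s')

module _ {X A : Set} (t' : NPLTS X A) where
  open NPLTSSem t'

  o-endpoints : ∀ s → o s ≡ (oT s , oB s)
  o-endpoints (var x)      = refl
  o-endpoints star         = refl
  o-endpoints (s ⊕ s')     rewrite o-endpoints s | o-endpoints s' = refl
  o-endpoints (mix p s s') rewrite o-endpoints s | o-endpoints s' = refl

  oB-mixFree : ∀ {s} → MixFree s → oB s ≡ indicator (any is-just (leaves s))
  oB-mixFree (var x) = refl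
  oB-mixFree star    = refl
  oB-mixFree (_⊕_ {s} {s'} m m')
    rewrite oB-mixFree m | oB-mixFree m' | any-++ is-just (leaves s) (leaves s')
    = indicator-∨ (any is-just (leaves s)) (any is-just (leaves s'))

  oT-mixFree : ∀ {s} → MixFree s → oT s ≡ indicator (not (any is-nothing (leaves s)))
  oT-mixFree (var x) = refl
  oT-mixFree star    = refl
  oT-mixFree (_⊕_ {s} {s'} m m')
    rewrite oT-mixFree m | oT-mixFree m' | any-++ is-nothing (leaves s) (leaves s')
    = indicator-not-∨ (any is-nothing (leaves s)) (any is-nothing (leaves s'))

module _ {X A : Set} (t : LTS X A) where
  open LTSSem t
  open NPLTSSem (diracLift t)

  leaves-τ-dirac : ∀ (y : X) ys → leaves (τ (map dvar (y ∷ ys))) ≡ map just (y ∷ ys)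
  leaves-τ-dirac y []       = refl
  leaves-τ-dirac y (z ∷ zs) = cong (just y ∷_) (leaves-τ-dirac z zs)

  mixFree-τ-dirac : ∀ (ys : List X) → MixFree (τ (map dvar ys))
  mixFree-τ-dirac []           = star
  mixFree-τ-dirac (y ∷ [])     = var y
  mixFree-τ-dirac (y ∷ z ∷ zs) = var y ⊕ mixFree-τ-dirac (z ∷ zs)

  leaves-step : ∀ s a → leaves (step s a) ≡ stepS (leaves s) a
  leaves-step (var x) a with t x a
  ... | []     = refl
  ... | y ∷ ys = trans (leaves-τ-dirac y ys) (sym (++-identityʳ _))
  leaves-step star a = refl
  leaves-step (s ⊕ s') a
    rewrite leaves-step s a | leaves-step s' a = sym (concatMap-++ (λ u → θ u a) (leaves s) (leaves s'))
  leaves-step (mix p s s') a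
    rewrite leaves-step s a | leaves-step s' a = sym (concatMap-++ (λ u → θ u a) (leaves s) (leaves s'))

  leaves-run : ∀ s w → leaves (run s w) ≡ runS (leaves s) w
  leaves-run s []      = refl
  leaves-run s (a ∷ w) rewrite leaves-run (step s a) w | leaves-step s a = refl

  mixFree-step : ∀ {s} → MixFree s → ∀ a → MixFree (step s a)
  mixFree-step (var x)  a = mixFree-τ-dirac (t x a)
  mixFree-step star     a = star
  mixFree-step (m ⊕ m') a = mixFree-step m a ⊕ mixFree-step m' a

  mixFree-run : ∀ {s} → MixFree s → ∀ w → MixFree (run s w)
  mixFree-run m []      = m
  mixFree-run m (a ∷ w) = mixFree-run (mixFree-step m a) w

  oB-run : ∀ x w → oB (run (var x) w) ≡ indicator (hasX (runS (just x ∷ []) w))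
  oB-run x w = trans (oB-mixFree (diracLift t) (mixFree-run (var x) w))
                     (cong (λ S → indicator (hasX S)) (leaves-run (var x) w))

  oT-run : ∀ x w → oT (run (var x) w) ≡ indicator (not (hasStar (runS (just x ∷ []) w)))
  oT-run x w = trans (oT-mixFree (diracLift t) (mixFree-run (var x) w))
                     (cong (λ S → indicator (not (hasStar S))) (leaves-run (var x) w))

  o-run : ∀ x w → o (run (var x) w) ≡ obsInterval (obs (runS (just x ∷ []) w))
  o-run x w = trans (o-endpoints (diracLift t) (run (var x) w)) (cong₂ _,_ (oT-run x w) (oB-run x w))

theorem7p9 : {X A : Set} (t : LTS X A) (x y : X) →
    (LTSSem._≡*_ t x y ⇔ NPLTSSem._≡ᴺ_ (diracLift t) x y)
    × (LTSSem._≡B_ t x y ⇔ NPLTSSem._≡ᴺB_ (diracLift t) x y)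
    × (LTSSem._≡T_ t x y ⇔ NPLTSSem._≡ᴺT_ (diracLift t) x y)
theorem7p9 t x y =
    pointwise-≡-transfer obsInterval-injective (o-run t x) (o-run t y)
  , pointwise-≡-transfer indicator-injective (oB-run t x) (oB-run t y)
  , pointwise-≡-transfer (not-injective ∘ indicator-injective) (oT-run t x) (oT-run t y)
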